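{- Let $w\in\mathcal B_n$. For every $j\in[n]$, \[\chi_j(w)=\mathbf 1\{\mathsf{Tag}_{j-1}(w)\in\{S,C\}\ \text{and}\ \mathsf{Tag}_j(w)\neq S\}.\]
   Context: $\mathcal B_n$ is the set of Boolean permutations in $S_n$: those admitting a reduced word in the simple transpositions $s_i=(i\ i{+}1)$ in which no $s_i$ appears more than once. $\chi_j(w)=1$ if there exists $k<j$ with $w(k)>w(j)$, else $0$. $\underline w$ is the lexicographically smallest reduced word of $w$ (comparing index sequences). For $j\ge i$, a block is $s_{j\downarrow i}:=s_js_{j-1}\cdots s_i$; the maximal block factorization of $\underline w$ writes it as a concatenation of maximal runs of consecutive letters whose indices decrease by exactly $1$ at each step. For $t\in[n-1]$: $\mathsf{Pres}_t(w)=1$ if $s_t$ appears in $\underline w$, else $0$; $\mathsf{Cont}_t(w)=1$ if some block $s_{j\downarrow i}$ of the maximal block factorization contains $s_t$ and has $i<t$, else $0$; $\mathsf{Tag}_t(w)=0$ if $\mathsf{Pres}_t(w)=0$, $=S$ if $\mathsf{Pres}_t(w)=1,\mathsf{Cont}_t(w)=0$, and $=C$ if $\mathsf{Pres}_t(w)=\mathsf{Cont}_t(w)=1$. For $t\notin\{1,\dots,n-1\}$, by convention $\mathsf{Tag}_t(w)=0$. -}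

module Defs where

open import Data.Nat using (ℕ; zero; suc; _≤_; _<_; _≡ᵇ_; _<ᵇ_; _∸_)
open import Data.Bool using (Bool; true; false; if_then_else_; _∧_; _∨_)
open import Data.List using (List; []; _∷_; length)
open import Data.Bool.ListAction using (any)
open import Data.List.Relation.Unary.All using (All)
open import Data.List.Relation.Unary.Unique.Propositional using (Unique)
open import Data.Fin using (Fin; toℕ)
open import Data.Fin.Permutation using (Permutation′; _⟨$⟩ʳ_)
open import Data.Product using (Σ; _×_)
open import Relation.Binary.PropositionalEquality using (_≡_)

s : ℕ → ℕ → ℕ
s i x = if x ≡ᵇ i then suc i else (if x ≡ᵇ suc i then i else x)

evalWord : List ℕ → ℕ → ℕ
evalWord []      x = x
evalWord (a ∷ u) x = s a (evalWord u x)

-- One-line value of w at 1-based position p (p = toℕ k + 1), 1-based value.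
val : ∀ {n} → Permutation′ n → Fin n → ℕ
val w k = suc (toℕ (w ⟨$⟩ʳ k))

IsWord : (n : ℕ) → Permutation′ n → List ℕ → Set
IsWord n w u = All (λ a → 1 ≤ a × a ≤ n ∸ 1) u × (∀ (k : Fin n) → val w k ≡ evalWord u (suc (toℕ k)))

IsReduced : (n : ℕ) → Permutation′ n → List ℕ → Set
IsReduced n w u = IsWord n w u × (∀ v → IsWord n w v → length u ≤ length v)

IsBoolean : (n : ℕ) → Permutation′ n → Set
IsBoolean n w = Σ (List ℕ) λ u → IsReduced n w u × Unique u

data LexLeq : List ℕ → List ℕ → Set where
  nil  : ∀ {v} → LexLeq [] v
  lt   : ∀ {a b u v} → a < b → LexLeq (a ∷ u) (b ∷ v)
  same : ∀ {a u v} → LexLeq u v → LexLeq (a ∷ u) (a ∷ v)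

IsLexMinReduced : (n : ℕ) → Permutation′ n → List ℕ → Set
IsLexMinReduced n w u = IsReduced n w u × (∀ v → IsReduced n w v → LexLeq u v)

Chi : ∀ {n} → Permutation′ n → Fin n → Set
Chi {n} w j = Σ (Fin n) λ k → toℕ k Data.Nat.< toℕ j × val w j Data.Nat.< val w k

-- Maximal block factorization: maximal runs of consecutive letters
-- whose indices decrease by exactly 1 at each step.
consBlock : ℕ → List (List ℕ) → List (List ℕ)
consBlock a []                  = (a ∷ []) ∷ []
consBlock a ([] ∷ rest)         = (a ∷ []) ∷ [] ∷ rest
consBlock a ((b ∷ bs) ∷ rest)   =
  if a ≡ᵇ suc b then (a ∷ b ∷ bs) ∷ rest else (a ∷ []) ∷ (b ∷ bs) ∷ rest

blocks : List ℕ → List (List ℕ)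
blocks []      = []
blocks (a ∷ u) = consBlock a (blocks u)

memᵇ : ℕ → List ℕ → Bool
memᵇ t = any (λ a → a ≡ᵇ t)

lastOf : List ℕ → ℕ
lastOf []          = 0
lastOf (a ∷ [])    = a
lastOf (a ∷ b ∷ l) = lastOf (b ∷ l)

Pres : List ℕ → ℕ → Bool
Pres u t = memᵇ t u

Cont : List ℕ → ℕ → Bool
Cont u t = any (λ b → memᵇ t b ∧ (lastOf b <ᵇ t)) (blocks u)

data TagVal : Set where
  T0 : TagVal
  S  : TagVal
  C  : TagVal

-- Tag_t computed from the word u (intended: u = lex-min reduced word of w ∈ S_n);
-- Tag_t = 0 for t ∉ {1,...,n-1}.
Tag : ℕ → List ℕ → ℕ → TagVal
Tag n u t =
  if (0 <ᵇ t) ∧ (t <ᵇ n)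
  then (if Pres u t then (if Cont u t then C else S) else T0)
  else T0

-- Write i for toℕ j, so that the position in question is p = i + 1.  Two properties of the
-- lexicographically least reduced word u of a Boolean permutation w drive the proof.  First, u has
-- no repeated letter: each letter t of a repetition-free reduced word of w sends some k ≤ t above t,
-- so t must occur in every word of w, and u is no longer than that word.  Second, no letter of u is
-- followed by one smaller by two or more, since the two commute and swapping them would give a
-- lexicographically smaller reduced word.
--
-- Apply the letters of u to p from the right.  Then χ_p(w) = 1 exactly when the value is pushed
-- down at some step, and when letters are distinct this happens exactly when s_i is applied before
-- s_{i+1}: i occurs in u and i + 1 does not occur to its right.  By the second property, i + 1
-- occurring to the left of i forces it to stand immediately before i, which is what Cont_{i+1}
-- detects; so the condition reads Tag_i ∈ {S, C} and Tag_{i+1} ≠ S.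

module Submission where

open import Defs
open import Data.Bool using (true; false; T; if_then_else_; _∧_; _∨_)
open import Data.Bool.Properties using (T-∧; T-∨; T-≡; if-eta)
open import Data.Empty using (⊥-elim)
open import Data.Fin using (Fin; toℕ; fromℕ<)
open import Data.Fin.Properties using (toℕ-fromℕ<; toℕ<n)
open import Data.Fin.Permutation using (Permutation′)
open import Data.List using (List; []; _∷_; _++_; length)
open import Data.List.Membership.Propositional using (_∈_; _∉_)
open import Data.List.Relation.Binary.Permutation.Propositional using (_↭_; ↭-refl; swap)
open import Data.List.Relation.Binary.Permutation.Propositional.Properties using (++⁺ˡ; ↭-length; All-resp-↭)
open import Data.List.Relation.Binary.Subset.Propositional using (_⊆_)
open import Data.List.Relation.Unary.All using (All)
open import Data.List.Relation.Unary.All.Properties using (¬Any⇒All¬)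
import Data.List.Relation.Unary.All as All
open import Data.List.Relation.Unary.AllPairs using ([]; _∷_)
import Data.List.Relation.Unary.Any as Any
open import Data.List.Relation.Unary.Any using (here; there)
open import Data.List.Relation.Unary.Any.Properties using (any⁺; any⁻)
open import Data.List.Relation.Unary.Linked using (Linked; []; [-]; _∷_)
import Data.List.Relation.Unary.Linked as Linked
open import Data.List.Relation.Unary.Unique.Propositional using (Unique)
open import Data.List.Relation.Unary.Unique.Propositional.Properties using (Unique[x∷xs]⇒x∉xs)
open import Data.Nat using (ℕ; zero; suc; _≤_; _<_; _≡ᵇ_; _<ᵇ_; _∸_; z≤n; s≤s; _≟_; _≤?_)
open import Data.Nat.Properties
open import Data.List.Membership.DecPropositional _≟_ using (_∈?_)
open import Data.Product using (_×_; _,_; proj₁; proj₂; ∃-syntax)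
open import Data.Product.Function.NonDependent.Propositional using (_×-⇔_)
open import Data.Sum using (_⊎_; inj₁; inj₂; [_,_])
open import Function using (_∘_; id; case_of_)
open import Function.Bundles using (_⇔_; mk⇔; Equivalence)
open import Function.Construct.Identity using (⇔-id)
import Function.Properties.Equivalence as ⇔
open import Function.Related.Propositional using (module EquationalReasoning)
open import Function.Related.TypeIsomorphisms using (¬-cong-⇔)
open import Relation.Nullary using (¬_; yes; no; contradiction)
open import Relation.Nullary.Decidable using (T?; dec-true; dec-false)
open import Relation.Binary.PropositionalEquality using (_≡_; _≢_; refl; sym; trans; cong; subst; subst₂; ≢-sym)

private
  variable
    a b c m n p t x y : ℕ
    u v : List ℕ

-- Simple transpositions

s-left : ∀ i → s i i ≡ suc i
s-left i rewrite dec-true (i ≟ i) refl = refl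

s-right : ∀ i → s i (suc i) ≡ i
s-right i rewrite dec-false (suc i ≟ i) 1+n≢n | dec-true (suc i ≟ suc i) refl = refl

s-fixes : ∀ i → x ≢ i → x ≢ suc i → s i x ≡ x
s-fixes {x} i x≢i x≢1+i rewrite dec-false (x ≟ i) x≢i | dec-false (x ≟ suc i) x≢1+i = refl

s-fixes-below : ∀ {i} → x < i → s i x ≡ x
s-fixes-below x<i = s-fixes _ (<⇒≢ x<i) (<⇒≢ (m<n⇒m<1+n x<i))

s-fixes-above : ∀ {i} → suc i < x → s i x ≡ x
s-fixes-above i+1<x = s-fixes _ (>⇒≢ (<-trans (n<1+n _) i+1<x)) (>⇒≢ i+1<x)

data SView (i : ℕ) : ℕ → ℕ → Set where
  lower : SView i i (suc i)
  upper : SView i (suc i) i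
  other : x ≢ i → x ≢ suc i → SView i x x

s-view : ∀ i x → SView i x (s i x)
s-view i x with x ≟ i | x ≟ suc i
... | yes refl | _        rewrite s-left i  = lower
... | no _     | yes refl rewrite s-right i = upper
... | no x≢i   | no x≢1+i rewrite s-fixes i x≢i x≢1+i = other x≢i x≢1+i

s-involutive : ∀ i x → s i (s i x) ≡ x
s-involutive i x with s i x | s-view i x
... | _ | lower = s-right i
... | _ | upper = s-left i
... | _ | other x≢i x≢1+i = s-fixes i x≢i x≢1+i

s-preserves-≤ : a ≢ t → x ≤ t → s a x ≤ t
s-preserves-≤ {a = a} {x = x} a≢t x≤t with s a x | s-view a x
... | _ | lower = ≤∧≢⇒< x≤t a≢t
... | _ | upper = ≤-trans (n≤1+n a) x≤t
... | _ | other _ _ = x≤t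

s-preserves-> : a ≢ t → t < x → t < s a x
s-preserves-> {a = a} {x = x} a≢t t<x with s a x | s-view a x
... | _ | lower = m<n⇒m<1+n t<x
... | _ | upper = ≤∧≢⇒< (≤-pred t<x) (≢-sym a≢t)
... | _ | other _ _ = t<x

s-preserves-< : ∀ a → x < y → ¬ (x ≡ a × y ≡ suc a) → s a x < s a y
s-preserves-< {x = x} {y = y} a x<y not-pair with s a x | s-view a x | s a y | s-view a y
... | _ | lower       | _ | lower          = contradiction x<y (<-irrefl refl)
... | _ | lower       | _ | upper          = contradiction (refl , refl) not-pair
... | _ | lower       | _ | other _ y≢1+a = ≤∧≢⇒< x<y (≢-sym y≢1+a)
... | _ | upper       | _ | lower          = contradiction x<y (<-asym (n<1+n a))
... | _ | upper       | _ | upper          = contradiction x<y (<-irrefl refl)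
... | _ | upper       | _ | other _ _      = <-trans (n<1+n a) x<y
... | _ | other _ _   | _ | lower          = m<n⇒m<1+n x<y
... | _ | other x≢a _ | _ | upper          = ≤∧≢⇒< (≤-pred x<y) x≢a
... | _ | other _ _   | _ | other _ _      = x<y

s-reflects-< : ∀ a → x ≢ suc a → s a x < s a y → x < y
s-reflects-< {x = x} {y = y} a x≢1+a sx<sy =
  subst₂ _<_ (s-involutive a x) (s-involutive a y) (s-preserves-< a sx<sy image-not-lower)
  where
    image-not-lower : ¬ (s a x ≡ a × s a y ≡ suc a)
    image-not-lower (sx≡a , _) =
      x≢1+a (trans (sym (s-involutive a x)) (trans (cong (s a) sx≡a) (s-left a)))

s-comm : suc b < a → ∀ z → s a (s b z) ≡ s b (s a z)
s-comm {b = b} {a = a} b+1<a z with s b z | s-view b z | s a z | s-view a z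
... | _ | lower | _ | lower = contradiction b+1<a (≤⇒≯ (n≤1+n _))
... | _ | lower | _ | upper = contradiction b+1<a (≤⇒≯ (m≤n+m _ 2))
... | _ | upper | _ | lower = contradiction b+1<a (≤⇒≯ ≤-refl)
... | _ | upper | _ | upper = contradiction b+1<a (≤⇒≯ (n≤1+n _))
... | _ | lower | _ | other _ _ rewrite s-fixes-below b+1<a | s-left b = refl
... | _ | upper | _ | other _ _ rewrite s-fixes-below (<-trans (n<1+n b) b+1<a) | s-right b = refl
... | _ | other _ _ | _ | lower rewrite s-left a | s-fixes-above (m<n⇒m<1+n b+1<a) = refl
... | _ | other _ _ | _ | upper rewrite s-right a | s-fixes-above b+1<a = refl
... | _ | other z≢b z≢1+b | _ | other z≢a z≢1+a
  rewrite s-fixes a z≢a z≢1+a | s-fixes b z≢b z≢1+b = refl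

-- Evaluating words

evalWord-preserves-≤ : t ∉ u → x ≤ t → evalWord u x ≤ t
evalWord-preserves-≤ {u = []}    _   x≤t = x≤t
evalWord-preserves-≤ {u = c ∷ u} t∉u x≤t =
  s-preserves-≤ (λ c≡t → t∉u (here (sym c≡t))) (evalWord-preserves-≤ (t∉u ∘ there) x≤t)

evalWord-preserves-> : t ∉ u → t < x → t < evalWord u x
evalWord-preserves-> {u = []}    _   t<x = t<x
evalWord-preserves-> {u = c ∷ u} t∉u t<x =
  s-preserves-> (λ c≡t → t∉u (here (sym c≡t))) (evalWord-preserves-> (t∉u ∘ there) t<x)

evalWord-reflects-≤ : t ∉ u → evalWord u x ≤ t → x ≤ t
evalWord-reflects-≤ t∉u ux≤t = ≮⇒≥ (λ t<x → <⇒≱ (evalWord-preserves-> t∉u t<x) ux≤t)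

evalWord-reflects-> : t ∉ u → t < evalWord u x → t < x
evalWord-reflects-> t∉u t<ux = ≰⇒> (λ x≤t → <⇒≱ t<ux (evalWord-preserves-≤ t∉u x≤t))

evalWord-fixes : m ∉ u → suc m ∉ u → evalWord u (suc m) ≡ suc m
evalWord-fixes m∉u 1+m∉u =
  ≤-antisym (evalWord-preserves-≤ 1+m∉u ≤-refl) (evalWord-preserves-> m∉u ≤-refl)

evalWord-fixes-zero : 0 ∉ u → evalWord u 0 ≡ 0
evalWord-fixes-zero 0∉u = n≤0⇒n≡0 (evalWord-preserves-≤ 0∉u z≤n)

evalWordInv : List ℕ → ℕ → ℕ
evalWordInv []      x = x
evalWordInv (a ∷ u) x = evalWordInv u (s a x)

evalWord-evalWordInv : ∀ u x → evalWord u (evalWordInv u x) ≡ x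
evalWord-evalWordInv []      x = refl
evalWord-evalWordInv (a ∷ u) x = trans (cong (s a) (evalWord-evalWordInv u (s a x))) (s-involutive a x)

InAlphabet : ℕ → List ℕ → Set
InAlphabet n = All (λ a → 1 ≤ a × a ≤ n ∸ 1)

letter-bounds : ∀ n → InAlphabet n u → t ∈ u → 0 < t × t < n
letter-bounds zero letters t∈u with All.lookup letters t∈u
... | 0<t , t≤0 = contradiction t≤0 (<⇒≱ 0<t)
letter-bounds (suc n) letters t∈u with All.lookup letters t∈u
... | 0<t , t≤n = 0<t , s≤s t≤n

0∉ : ∀ n → InAlphabet n u → 0 ∉ u
0∉ n letters 0∈u = <-irrefl refl (proj₁ (letter-bounds n letters 0∈u))

-- χ and descents

ChiWord : List ℕ → ℕ → Set
ChiWord u p = ∃[ q ] q < p × evalWord u p < evalWord u q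

Chi⇔ChiWord : ∀ {w : Permutation′ n} → IsWord n w u → (j : Fin n) → Chi w j ⇔ ChiWord u (suc (toℕ j))
Chi⇔ChiWord {n = n} {u = u} {w = w} (letters , evaluates) j = mk⇔ to from
  where
    to : Chi w j → ChiWord u (suc (toℕ j))
    to (k , k<j , wj<wk) = suc (toℕ k) , s≤s k<j , subst₂ _<_ (evaluates j) (evaluates k) wj<wk
    from : ChiWord u (suc (toℕ j)) → Chi w j
    from (zero , _ , uj<u0) =
      ⊥-elim (n≮0 (subst (evalWord u (suc (toℕ j)) <_) (evalWord-fixes-zero (0∉ n letters)) uj<u0))
    from (suc q , q<1+j , uj<uq) = k , subst (_< toℕ j) (sym toℕk≡q) (≤-pred q<1+j) , wj<wk
      where
        q<n : q < n
        q<n = <-trans (≤-pred q<1+j) (toℕ<n j)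
        k : Fin n
        k = fromℕ< q<n
        toℕk≡q : toℕ k ≡ q
        toℕk≡q = toℕ-fromℕ< q<n
        wj<wk : val w j < val w k
        wj<wk = subst₂ _<_ (sym (evaluates j))
                           (sym (trans (evaluates k) (cong (λ r → evalWord u (suc r)) toℕk≡q))) uj<uq

-- Applying the letters of u from the right, the value p is at some step moved from a + 1 down to a.
data Descent (p : ℕ) : List ℕ → Set where
  descends : evalWord u p ≡ suc a → Descent p (a ∷ u)
  later    : Descent p u → Descent p (a ∷ u)

ChiWord⇒Descent : ∀ u → ChiWord u p → Descent p u
ChiWord⇒Descent []      (q , q<p , p<q) = contradiction p<q (<-asym q<p)
ChiWord⇒Descent {p} (a ∷ u) (q , q<p , sup<suq) with evalWord u p ≟ suc a
... | yes up≡1+a = descends up≡1+a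
... | no  up≢1+a = later (ChiWord⇒Descent u (q , q<p , s-reflects-< a up≢1+a sup<suq))

Descent⇒ChiWord : Unique u → Descent p u → ChiWord u p
Descent⇒ChiWord {a ∷ u} {p} un (descends up≡1+a) = q , ≤-<-trans q≤a a<p , sup<suq
  where
    a∉u : a ∉ u
    a∉u = Unique[x∷xs]⇒x∉xs un
    q : ℕ
    q = evalWordInv u a
    uq≡a : evalWord u q ≡ a
    uq≡a = evalWord-evalWordInv u a
    q≤a : q ≤ a
    q≤a = evalWord-reflects-≤ a∉u (≤-reflexive uq≡a)
    a<p : a < p
    a<p = evalWord-reflects-> a∉u (subst (a <_) (sym up≡1+a) (n<1+n a))
    sup<suq : s a (evalWord u p) < s a (evalWord u q)
    sup<suq rewrite up≡1+a | uq≡a | s-right a | s-left a = n<1+n a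
Descent⇒ChiWord {a ∷ u} {p} un@(_ ∷ u!) (later d) with Descent⇒ChiWord u! d
... | q , q<p , up<uq = q , q<p , s-preserves-< a up<uq not-swapped
  where
    a∉u : a ∉ u
    a∉u = Unique[x∷xs]⇒x∉xs un
    not-swapped : ¬ (evalWord u p ≡ a × evalWord u q ≡ suc a)
    not-swapped (up≡a , uq≡1+a) = <-irrefl refl (subst (a <_) up≡a (evalWord-preserves-> a∉u a<p))
      where
        a<p : a < p
        a<p = <-trans (evalWord-reflects-> a∉u (subst (a <_) (sym uq≡1+a) (n<1+n a))) q<p

ChiWord⇔Descent : Unique u → ChiWord u p ⇔ Descent p u
ChiWord⇔Descent {u = u} un = mk⇔ (ChiWord⇒Descent u) (Descent⇒ChiWord un)

-- Relative order of letters

data Precedes (a b : ℕ) : List ℕ → Set where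
  precedes : b ∈ u → Precedes a b (a ∷ u)
  later    : Precedes a b u → Precedes a b (c ∷ u)

data Consecutive (a b : ℕ) : List ℕ → Set where
  consecutive : Consecutive a b (a ∷ b ∷ u)
  later       : Consecutive a b u → Consecutive a b (c ∷ u)

Precedes⇒∈ : Precedes a b u → b ∈ u
Precedes⇒∈ (precedes b∈u) = there b∈u
Precedes⇒∈ (later ab)     = there (Precedes⇒∈ ab)

Precedes-total : a ∈ u → b ∈ u → a ≢ b → Precedes a b u ⊎ Precedes b a u
Precedes-total (here refl) (here refl) a≢b = contradiction refl a≢b
Precedes-total (here refl) (there b∈u) _   = inj₁ (precedes b∈u)
Precedes-total (there a∈u) (here refl) _   = inj₂ (precedes a∈u)
Precedes-total (there a∈u) (there b∈u) a≢b = Data.Sum.map later later (Precedes-total a∈u b∈u a≢b)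

Precedes-asym : Unique u → Precedes a b u → ¬ Precedes b a u
Precedes-asym un       (precedes b∈u) (precedes _) = Unique[x∷xs]⇒x∉xs un b∈u
Precedes-asym un       (precedes _)   (later ba)   = Unique[x∷xs]⇒x∉xs un (Precedes⇒∈ ba)
Precedes-asym un       (later ab)     (precedes _) = Unique[x∷xs]⇒x∉xs un (Precedes⇒∈ ab)
Precedes-asym (_ ∷ un) (later ab)     (later ba)   = Precedes-asym un ab ba

Consecutive⇒Precedes : Consecutive a b u → Precedes a b u
Consecutive⇒Precedes consecutive = precedes (here refl)
Consecutive⇒Precedes (later ab)  = later (Consecutive⇒Precedes ab)

Descent⇒∈ : Unique u → Descent (suc m) u → m ∈ u
Descent⇒∈ {a ∷ u} {m} un (descends u[1+m]≡1+a) with a ≟ m | m ∈? u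
... | yes refl | _        = here refl
... | no  _    | yes m∈u  = there m∈u
... | no  a≢m  | no  m∉u  = contradiction (≤-antisym a≤m m≤a) a≢m
  where
    a≤m : a ≤ m
    a≤m = ≤-pred (evalWord-reflects-> (Unique[x∷xs]⇒x∉xs un) (subst (a <_) (sym u[1+m]≡1+a) (n<1+n a)))
    m≤a : m ≤ a
    m≤a = ≤-pred (subst (m <_) u[1+m]≡1+a (evalWord-preserves-> m∉u (n<1+n m)))
Descent⇒∈ (_ ∷ un) (later d) = there (Descent⇒∈ un d)

evalWord-raises-suc : Unique u → suc m ∈ u → ¬ Precedes (suc m) m u → suc m < evalWord u (suc m)
evalWord-raises-suc {_ ∷ u} {m} un (here refl) ¬prec
  rewrite evalWord-fixes (¬prec ∘ precedes) (Unique[x∷xs]⇒x∉xs un) | s-left (suc m) = n<1+n (suc m)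
evalWord-raises-suc {c ∷ u} un@(_ ∷ u!) (there 1+m∈u) ¬prec =
  s-preserves-> (λ { refl → Unique[x∷xs]⇒x∉xs un 1+m∈u }) (evalWord-raises-suc u! 1+m∈u (¬prec ∘ later))

Descent⇒¬Precedes : Unique u → Descent (suc m) u → ¬ Precedes m (suc m) u
Descent⇒¬Precedes un@(_ ∷ u!) (descends u[1+m]≡1+m) (precedes 1+m∈u) =
  <-irrefl (sym u[1+m]≡1+m) (evalWord-raises-suc u! 1+m∈u (Unique[x∷xs]⇒x∉xs un ∘ Precedes⇒∈))
Descent⇒¬Precedes {c ∷ u} {m} un@(_ ∷ u!) (descends u[1+m]≡1+c) (later p) = <⇒≱ m<c c≤m
  where
    m<c : m < c
    m<c = ≤-pred (subst (suc m <_) u[1+m]≡1+c (evalWord-raises-suc u! (Precedes⇒∈ p) (Precedes-asym u! p)))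
    c≤m : c ≤ m
    c≤m = ≤-pred (evalWord-reflects-> (Unique[x∷xs]⇒x∉xs un) (subst (c <_) (sym u[1+m]≡1+c) (n<1+n c)))
Descent⇒¬Precedes un@(_ ∷ u!) (later d) (precedes _) = Unique[x∷xs]⇒x∉xs un (Descent⇒∈ u! d)
Descent⇒¬Precedes (_ ∷ u!) (later d) (later p) = Descent⇒¬Precedes u! d p

¬Precedes⇒Descent : Unique u → m ∈ u → ¬ Precedes m (suc m) u → Descent (suc m) u
¬Precedes⇒Descent un (here refl) ¬prec =
  descends (evalWord-fixes (Unique[x∷xs]⇒x∉xs un) (¬prec ∘ precedes))
¬Precedes⇒Descent (_ ∷ un) (there m∈u) ¬prec = later (¬Precedes⇒Descent un m∈u (¬prec ∘ later))

Descent⇔ : Unique u → Descent (suc m) u ⇔ (m ∈ u × ¬ Precedes m (suc m) u)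
Descent⇔ un = mk⇔ (λ d → Descent⇒∈ un d , Descent⇒¬Precedes un d)
                   (λ (m∈u , ¬prec) → ¬Precedes⇒Descent un m∈u ¬prec)

DropsByAtMostOne : List ℕ → Set
DropsByAtMostOne = Linked (λ a b → a ≤ suc b)

drops-pass-through-suc : DropsByAtMostOne (c ∷ u) → m < c → m ∈ c ∷ u → suc m ∈ c ∷ u
drops-pass-through-suc _ m<c (here refl) = contradiction m<c (<-irrefl refl)
drops-pass-through-suc {c} {m = m} (c≤1+d ∷ drops) m<c (there m∈u) with c ≟ suc m
... | yes refl   = here refl
... | no  c≢1+m  =
  there (drops-pass-through-suc drops (≤-pred (≤-trans (≤∧≢⇒< m<c (≢-sym c≢1+m)) c≤1+d)) m∈u)

Precedes⇒Consecutive : Unique u → DropsByAtMostOne u → Precedes (suc m) m u → Consecutive (suc m) m u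
Precedes⇒Consecutive {m = m} un (1+m≤1+d ∷ drops) (precedes {d ∷ _} m∈u) with d ≟ m
... | yes refl = consecutive
... | no  d≢m  = contradiction
  (drops-pass-through-suc drops (≤∧≢⇒< (≤-pred 1+m≤1+d) (≢-sym d≢m)) m∈u) (Unique[x∷xs]⇒x∉xs un)
Precedes⇒Consecutive (_ ∷ un) drops (later p) = later (Precedes⇒Consecutive un (Linked.tail drops) p)

¬Precedes⇔¬Consecutive : Unique u → DropsByAtMostOne u →
  (m ∈ u × ¬ Precedes m (suc m) u) ⇔ (m ∈ u × ¬ (suc m ∈ u × ¬ Consecutive (suc m) m u))
¬Precedes⇔¬Consecutive {m = m} un drops = mk⇔
  (λ (m∈u , ¬prec) → m∈u , λ (1+m∈u , ¬cons) →
    [ ¬prec , ¬cons ∘ Precedes⇒Consecutive un drops ] (Precedes-total m∈u 1+m∈u (<⇒≢ (n<1+n m))))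
  (λ (m∈u , ¬[1+m∈u×¬cons]) → m∈u , λ prec →
    ¬[1+m∈u×¬cons] (Precedes⇒∈ prec , Precedes-asym un prec ∘ Consecutive⇒Precedes))

-- Lexicographically least reduced words

evalWord-swap : suc b < a → ∀ x y z → evalWord (x ++ a ∷ b ∷ y) z ≡ evalWord (x ++ b ∷ a ∷ y) z
evalWord-swap b+1<a []      y z = s-comm b+1<a (evalWord y z)
evalWord-swap b+1<a (c ∷ x) y z = cong (s c) (evalWord-swap b+1<a x y z)

IsReduced-swap : ∀ {w : Permutation′ n} x y → suc b < a →
  IsReduced n w (x ++ a ∷ b ∷ y) → IsReduced n w (x ++ b ∷ a ∷ y)
IsReduced-swap {b = b} {a = a} x y b+1<a ((letters , evaluates) , minimal) =
  (All-resp-↭ swapped letters , λ k → trans (evaluates k) (evalWord-swap b+1<a x y _)) ,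
  λ v v-word → subst (_≤ length v) (↭-length swapped) (minimal v v-word)
  where
    swapped : x ++ a ∷ b ∷ y ↭ x ++ b ∷ a ∷ y
    swapped = ++⁺ˡ x (swap a b ↭-refl)

¬LexLeq-swap : ∀ x y → b < a → ¬ LexLeq (x ++ a ∷ b ∷ y) (x ++ b ∷ a ∷ y)
¬LexLeq-swap []      y b<a (lt a<b)  = <-asym a<b b<a
¬LexLeq-swap []      y b<a (same _)  = <-irrefl refl b<a
¬LexLeq-swap (c ∷ x) y b<a (lt c<c)  = <-irrefl refl c<c
¬LexLeq-swap (c ∷ x) y b<a (same le) = ¬LexLeq-swap x y b<a le

Linked-of-factors : ∀ {R : ℕ → ℕ → Set} u → (∀ x a b y → u ≡ x ++ a ∷ b ∷ y → R a b) → Linked R u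
Linked-of-factors []          _ = []
Linked-of-factors (a ∷ [])    _ = [-]
Linked-of-factors (a ∷ b ∷ y) R-factors =
  R-factors [] a b y refl ∷
  Linked-of-factors (b ∷ y) (λ x a′ b′ y′ eq → R-factors (a ∷ x) a′ b′ y′ (cong (a ∷_) eq))

lexMin⇒DropsByAtMostOne : ∀ {w : Permutation′ n} → IsLexMinReduced n w u → DropsByAtMostOne u
lexMin⇒DropsByAtMostOne {n = n} {u = u} {w = w} (reduced , least) = Linked-of-factors u small-drop
  where
    small-drop : ∀ x a b y → u ≡ x ++ a ∷ b ∷ y → a ≤ suc b
    small-drop x a b y u≡xaby with a ≤? suc b
    ... | yes a≤1+b = a≤1+b
    ... | no  a≰1+b = contradiction (subst (λ v → LexLeq v _) u≡xaby (least _ swapped))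
                                    (¬LexLeq-swap x y (<-trans (n<1+n b) (≰⇒> a≰1+b)))
      where
        swapped : IsReduced n w (x ++ b ∷ a ∷ y)
        swapped = IsReduced-swap {n = n} {w = w} x y (≰⇒> a≰1+b) (subst (IsReduced n w) u≡xaby reduced)

remove-∈ : ∀ u → t ∈ u → ∃[ v ] length u ≡ suc (length v) × (∀ {x} → x ∈ u → x ≢ t → x ∈ v)
remove-∈ (c ∷ u) (here refl) =
  u , refl , λ { (here refl) x≢t → contradiction refl x≢t ; (there x∈u) _ → x∈u }
remove-∈ (c ∷ u) (there t∈u) with remove-∈ u t∈u
... | v , len , keeps =
  c ∷ v , cong suc len , λ { (here refl) _ → here refl ; (there x∈u) x≢t → there (keeps x∈u x≢t) }

Unique-length-≤ : Unique u → u ⊆ v → length u ≤ length v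
Unique-length-≤ {[]}    _              _   = z≤n
Unique-length-≤ {c ∷ u} {v} un@(_ ∷ u!) u⊆v with remove-∈ v (u⊆v (here refl))
... | v′ , len , keeps = subst (suc (length u) ≤_) (sym len) (s≤s (Unique-length-≤ u! u⊆v′))
  where
    u⊆v′ : u ⊆ v′
    u⊆v′ x∈u = keeps (u⊆v (there x∈u)) (λ { refl → Unique[x∷xs]⇒x∉xs un x∈u })

Unique⊎shorter-cover : ∀ u → Unique u ⊎ ∃[ v ] length v < length u × u ⊆ v
Unique⊎shorter-cover []      = inj₁ []
Unique⊎shorter-cover (c ∷ u) with Unique⊎shorter-cover u | c ∈? u
... | inj₂ (v , shorter , u⊆v) | _ =
  inj₂ (c ∷ v , s≤s shorter , λ { (here refl) → here refl ; (there x∈u) → there (u⊆v x∈u) })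
... | inj₁ _  | yes c∈u = inj₂ (u , ≤-refl , λ { (here refl) → c∈u ; (there x∈u) → x∈u })
... | inj₁ un | no  c∉u = inj₁ (¬Any⇒All¬ u c∉u ∷ un)

IsWord-agree : ∀ {w : Permutation′ n} → IsWord n w u → IsWord n w v → x ≤ n → evalWord u x ≡ evalWord v x
IsWord-agree {n = n} {x = zero} (u-letters , _) (v-letters , _) _ =
  trans (evalWord-fixes-zero (0∉ n u-letters)) (sym (evalWord-fixes-zero (0∉ n v-letters)))
IsWord-agree {u = u} {v = v} {x = suc q} (_ , u-evaluates) (_ , v-evaluates) q<n =
  subst (λ r → evalWord u (suc r) ≡ evalWord v (suc r)) (toℕ-fromℕ< q<n)
    (trans (sym (u-evaluates (fromℕ< q<n))) (v-evaluates (fromℕ< q<n)))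

letter-raises : Unique u → t ∈ u → ∃[ k ] k ≤ t × t < evalWord u k
letter-raises {c ∷ u} {t} un (here refl) = k , k≤t , t<tuk
  where
    k : ℕ
    k = evalWordInv u t
    uk≡t : evalWord u k ≡ t
    uk≡t = evalWord-evalWordInv u t
    k≤t : k ≤ t
    k≤t = evalWord-reflects-≤ (Unique[x∷xs]⇒x∉xs un) (≤-reflexive uk≡t)
    t<tuk : t < s t (evalWord u k)
    t<tuk rewrite uk≡t | s-left t = n<1+n t
letter-raises {c ∷ u} un@(_ ∷ u!) (there t∈u) with letter-raises u! t∈u
... | k , k≤t , t<uk = k , k≤t , s-preserves-> (λ { refl → Unique[x∷xs]⇒x∉xs un t∈u }) t<uk

Unique-word-letters-⊆ : ∀ {w : Permutation′ n} → IsWord n w u → IsWord n w v → Unique v → v ⊆ u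
Unique-word-letters-⊆ {n = n} {u = u} {v = v} {w = w} u-word v-word v-unique {t} t∈v with t ∈? u
... | yes t∈u = t∈u
... | no  t∉u with letter-raises v-unique t∈v
...   | k , k≤t , t<vk = contradiction (subst (_≤ t) uk≡vk (evalWord-preserves-≤ t∉u k≤t)) (<⇒≱ t<vk)
  where
    k≤n : k ≤ n
    k≤n = <⇒≤ (≤-<-trans k≤t (proj₂ (letter-bounds n (proj₁ v-word) t∈v)))
    uk≡vk : evalWord u k ≡ evalWord v k
    uk≡vk = IsWord-agree {n = n} {w = w} u-word v-word k≤n

lexMin⇒Unique : ∀ {w : Permutation′ n} → IsBoolean n w → IsLexMinReduced n w u → Unique u
lexMin⇒Unique {n = n} {u = u} {w = w} (u₀ , (u₀-word , _) , u₀-unique) ((u-word , u-minimal) , _)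
  with Unique⊎shorter-cover u
... | inj₁ u-unique = u-unique
... | inj₂ (v , shorter , u⊆v) = contradiction (u-minimal u₀ u₀-word) (<⇒≱ (≤-<-trans u₀-short shorter))
  where
    u₀⊆u : u₀ ⊆ u
    u₀⊆u = Unique-word-letters-⊆ {n = n} {w = w} u-word u₀-word u₀-unique
    u₀-short : length u₀ ≤ length v
    u₀-short = Unique-length-≤ u₀-unique (u⊆v ∘ u₀⊆u)

-- Tags

T-memᵇ : T (memᵇ t u) ⇔ t ∈ u
T-memᵇ = mk⇔ (Any.map (λ a≡ᵇt → sym (≡ᵇ⇒≡ _ _ a≡ᵇt)) ∘ any⁻ _ _)
             (any⁺ _ ∘ Any.map (λ t≡a → ≡⇒≡ᵇ _ _ (sym t≡a)))

Tag-absent : ∀ n → t ∉ u → Tag n u t ≡ T0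
Tag-absent {t = t} {u = u} n t∉u
  rewrite dec-false (T? (memᵇ t u)) (t∉u ∘ Equivalence.to T-memᵇ) = if-eta ((0 <ᵇ t) ∧ (t <ᵇ n))

Tag-present : ∀ n → InAlphabet n u → t ∈ u → Tag n u t ≡ (if Cont u t then C else S)
Tag-present {u = u} {t = t} n letters t∈u with letter-bounds n letters t∈u
... | 0<t , t<n
  rewrite Equivalence.to T-≡ (<⇒<ᵇ 0<t) | Equivalence.to T-≡ (<⇒<ᵇ t<n)
        | Equivalence.to T-≡ (Equivalence.from (T-memᵇ {u = u}) t∈u) = refl

Tag-S⊎C⇔∈ : ∀ n → InAlphabet n u → (Tag n u t ≡ S ⊎ Tag n u t ≡ C) ⇔ t ∈ u
Tag-S⊎C⇔∈ {u = u} {t = t} n letters = mk⇔ to from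
  where
    to : Tag n u t ≡ S ⊎ Tag n u t ≡ C → t ∈ u
    to tag with t ∈? u
    ... | yes t∈u = t∈u
    ... | no  t∉u =
      contradiction (subst (λ τ → τ ≡ S ⊎ τ ≡ C) (Tag-absent n t∉u) tag) λ { (inj₁ ()) ; (inj₂ ()) }
    from : t ∈ u → Tag n u t ≡ S ⊎ Tag n u t ≡ C
    from t∈u = subst (λ τ → τ ≡ S ⊎ τ ≡ C) (sym (Tag-present n letters t∈u)) (S-or-C (Cont u t))
      where
        S-or-C : ∀ b → (if b then C else S) ≡ S ⊎ (if b then C else S) ≡ C
        S-or-C true  = inj₂ refl
        S-or-C false = inj₁ refl

Tag≡S⇔ : ∀ n → InAlphabet n u → Tag n u t ≡ S ⇔ (t ∈ u × ¬ T (Cont u t))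
Tag≡S⇔ {u = u} {t = t} n letters = mk⇔ to from
  where
    to : Tag n u t ≡ S → t ∈ u × ¬ T (Cont u t)
    to tag≡S = t∈u , λ cont →
      case subst (λ b → (if b then C else S) ≡ S) (Equivalence.to T-≡ cont)
                 (trans (sym (Tag-present n letters t∈u)) tag≡S) of λ ()
      where
        t∈u : t ∈ u
        t∈u = Equivalence.to (Tag-S⊎C⇔∈ n letters) (inj₁ tag≡S)
    from : t ∈ u × ¬ T (Cont u t) → Tag n u t ≡ S
    from (t∈u , ¬cont) =
      trans (Tag-present n letters t∈u) (cong (λ b → if b then C else S) (dec-false (T? (Cont u t)) ¬cont))

≡ᵇ-true⇒≡ : ∀ a t → (a ≡ᵇ t) ≡ true → a ≡ t
≡ᵇ-true⇒≡ a t a≡ᵇt = ≡ᵇ⇒≡ a t (Equivalence.from T-≡ a≡ᵇt)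

blocks-head : ∀ b u → ∃[ bs ] ∃[ rest ] blocks (b ∷ u) ≡ (b ∷ bs) ∷ rest × lastOf (b ∷ bs) ≤ b
blocks-head b []      = [] , [] , refl , ≤-refl
blocks-head b (c ∷ u) with blocks-head c u
... | cs , rest , eq , last≤c rewrite eq with b ≡ᵇ suc c in b≡ᵇ1+c
... | true  = c ∷ cs , rest , refl ,
  ≤-trans last≤c (≤-trans (n≤1+n c) (≤-reflexive (sym (≡ᵇ-true⇒≡ b (suc c) b≡ᵇ1+c))))
... | false = [] , (c ∷ cs) ∷ rest , refl , ≤-refl

Cont-∷∷ : ∀ a b u t → Cont (a ∷ b ∷ u) t ≡ ((a ≡ᵇ suc b) ∧ (a ≡ᵇ t)) ∨ Cont (b ∷ u) t
Cont-∷∷ a b u t with blocks-head b u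
... | bs , rest , eq , last≤b rewrite eq with a ≡ᵇ suc b in a≡ᵇ1+b
... | false with a ≡ᵇ t in a≡ᵇt
...   | false = refl
...   | true rewrite ≡ᵇ-true⇒≡ a t a≡ᵇt | dec-false (T? (t <ᵇ t)) (<-irrefl refl ∘ <ᵇ⇒< t t) = refl
Cont-∷∷ a b u t | bs , rest , eq , last≤b | true with a ≡ᵇ t in a≡ᵇt
...   | false = refl
...   | true with ≡ᵇ-true⇒≡ a (suc b) a≡ᵇ1+b | ≡ᵇ-true⇒≡ a t a≡ᵇt
...     | refl | refl rewrite Equivalence.to T-≡ (<⇒<ᵇ (s≤s last≤b)) = refl

Cont-singleton : ∀ a t → ¬ T (Cont (a ∷ []) t)
Cont-singleton a t with a ≡ᵇ t in a≡ᵇt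
... | false = λ ()
... | true  = λ cont → <-irrefl (≡ᵇ-true⇒≡ a t a≡ᵇt)
                                (<ᵇ⇒< a t ([ id , (λ ()) ] (Equivalence.to (T-∨ {a <ᵇ t} {false}) cont)))

T-Cont⇔Consecutive : T (Cont u (suc m)) ⇔ Consecutive (suc m) m u
T-Cont⇔Consecutive {m = m} = mk⇔ (to _) from
  where
    to : ∀ u → T (Cont u (suc m)) → Consecutive (suc m) m u
    to (a ∷ [])    cont = contradiction cont (Cont-singleton a (suc m))
    to (a ∷ b ∷ u) cont =
      [ adjacent , later ∘ to (b ∷ u) ] (Equivalence.to T-∨ (subst T (Cont-∷∷ a b u (suc m)) cont))
      where
        adjacent : T ((a ≡ᵇ suc b) ∧ (a ≡ᵇ suc m)) → Consecutive (suc m) m (a ∷ b ∷ u)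
        adjacent pair with Equivalence.to T-∧ pair
        ... | a≡ᵇ1+b , a≡ᵇ1+m with ≡ᵇ⇒≡ a (suc b) a≡ᵇ1+b | ≡ᵇ⇒≡ a (suc m) a≡ᵇ1+m
        ...   | refl | refl = consecutive
    from : Consecutive (suc m) m u → T (Cont u (suc m))
    from (consecutive {u}) = subst T (sym (Cont-∷∷ (suc m) m u (suc m)))
      (Equivalence.from T-∨ (inj₁ (Equivalence.from T-∧ (1+m≡ᵇ1+m , 1+m≡ᵇ1+m))))
      where
        1+m≡ᵇ1+m : T (suc m ≡ᵇ suc m)
        1+m≡ᵇ1+m = ≡⇒≡ᵇ (suc m) (suc m) refl
    from (later {u = b ∷ u} {c = c} cons) =
      subst T (sym (Cont-∷∷ c b u (suc m))) (Equivalence.from T-∨ (inj₂ (from cons)))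

Tag-suc≡S⇔ : ∀ n → InAlphabet n u → Tag n u (suc m) ≡ S ⇔ (suc m ∈ u × ¬ Consecutive (suc m) m u)
Tag-suc≡S⇔ n letters = ⇔.trans (Tag≡S⇔ n letters) (⇔-id _ ×-⇔ ¬-cong-⇔ T-Cont⇔Consecutive)

lemma5p4 : (n : ℕ) (w : Permutation′ n) → IsBoolean n w →
    (u : List ℕ) → IsLexMinReduced n w u → (j : Fin n) →
    Chi w j ⇔ ((Tag n u (toℕ j) ≡ S ⊎ Tag n u (toℕ j) ≡ C) × ¬ (Tag n u (suc (toℕ j)) ≡ S))
lemma5p4 n w boolean u lexMin j =
  begin
    Chi w j
  ∼⟨ Chi⇔ChiWord {w = w} word j ⟩
    ChiWord u (suc i)
  ∼⟨ ChiWord⇔Descent unique ⟩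
    Descent (suc i) u
  ∼⟨ Descent⇔ unique ⟩
    (i ∈ u × ¬ Precedes i (suc i) u)
  ∼⟨ ¬Precedes⇔¬Consecutive unique (lexMin⇒DropsByAtMostOne {w = w} lexMin) ⟩
    (i ∈ u × ¬ (suc i ∈ u × ¬ Consecutive (suc i) i u))
  ∼⟨ ⇔.sym (Tag-S⊎C⇔∈ n letters ×-⇔ ¬-cong-⇔ (Tag-suc≡S⇔ n letters)) ⟩
    ((Tag n u i ≡ S ⊎ Tag n u i ≡ C) × ¬ (Tag n u (suc i) ≡ S))
  ∎
  where
    open EquationalReasoning
    i : ℕ
    i = toℕ j
    word : IsWord n w u
    word = proj₁ (proj₁ lexMin)
    letters : InAlphabet n u
    letters = proj₁ word
    unique : Unique u
    unique = lexMin⇒Unique {w = w} boolean lexMin
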